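{- For every $n\in\mathbb{N}$, the graph $G(5,n)$ is connected and has diameter at most $3$.
   Context: For a prime $p$ and $n\in\mathbb{N}$, $G(p,n)$ is the simple graph with vertex set $\{2,4,\ldots,2n\}$ in which two distinct vertices $a,b$ are adjacent if and only if both $\frac{a+b}{2}$ and $\frac{|a-b|}{2}$ are odd positive integers neither of which equals $pk$ for an integer $k\ge 2$. -}

module Defs where

open import Data.Nat using (ℕ; zero; suc; _+_; _*_; _≤_; _<_; _/_; _%_; ∣_-_∣)
open import Data.Product using (Σ; ∃; _×_)
open import Relation.Binary.PropositionalEquality using (_≡_; _≢_)
open import Relation.Nullary using (¬_)

Vertex : ℕ → ℕ → Set
Vertex n a = Σ ℕ λ i → 1 ≤ i × i ≤ n × a ≡ 2 * i

Odd : ℕ → Set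
Odd m = m % 2 ≡ 1

Admissible : ℕ → ℕ → Set
Admissible p m = Odd m × 0 < m × ¬ (∃ λ k → 2 ≤ k × m ≡ p * k)

Adj : ℕ → ℕ → ℕ → ℕ → Set
Adj p n a b = Vertex n a × Vertex n b × a ≢ b
            × Admissible p ((a + b) / 2) × Admissible p (∣ a - b ∣ / 2)

data Walk (p n : ℕ) : ℕ → ℕ → ℕ → Set where
  here : ∀ {a} → Vertex n a → Walk p n a a 0
  step : ∀ {a b c ℓ} → Adj p n a b → Walk p n b c ℓ → Walk p n a c (suc ℓ)

Connected : ℕ → ℕ → Set
Connected p n = ∀ a b → Vertex n a → Vertex n b → ∃ λ ℓ → Walk p n a b ℓ

DiameterAtMost : ℕ → ℕ → ℕ → Set
DiameterAtMost p n d =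
  ∀ a b → Vertex n a → Vertex n b → ∃ λ ℓ → ℓ ≤ d × Walk p n a b ℓ

{-# OPTIONS --safe #-}
-- Index the vertex 2i by i. Then 2i and 2j are adjacent exactly when i + j is odd and
-- neither i + j nor |i − j| is an odd multiple of 5 other than 5 itself. Two indices of
-- equal parity have a common neighbour x ≤ 10 of the other parity: for n ≥ 10 some such x
-- avoids ±i and ±j modulo 5, and for n ≤ 9 one of x = 1, 2 keeps every sum below 15.
-- Indices of different parity are joined by a step from i to any neighbour of i,
-- which has the parity of j, followed by such a two-step walk.
module Submission where

open import Defs
open import Data.Fin using (Fin; toℕ; fromℕ<)
open import Data.Fin.Properties using (all?; any?; toℕ-fromℕ<; toℕ≤pred[n])
open import Data.Nat
  using (ℕ; zero; suc; _+_; _*_; _∸_; _≤_; _<_; _/_; _%_; ∣_-_∣; _⊓_; NonZero; z≤n; s≤s; _≟_; _≤?_)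
open import Data.Nat.Properties
open import Data.Nat.DivMod
open import Data.Nat.Divisibility using (_∣_; divides; n∣m⇒m%n≡0)
open import Data.Nat.Tactic.RingSolver using (solve-∀)
open import Data.Product using (_×_; _,_; ∃; proj₁; proj₂)
open import Data.Sum using (_⊎_; inj₁; inj₂)
open import Data.Unit using (tt)
open import Function using (_∘_)
open import Relation.Nullary using (¬_; Dec; yes; no; contradiction)
open import Relation.Nullary.Decidable using (_×-dec_; ¬?; toWitness)
open import Relation.Binary.PropositionalEquality
open ≡-Reasoning

Even : ℕ → Set
Even m = m % 2 ≡ 0

odd⇒>0 : ∀ {m} → Odd m → 0 < m
odd⇒>0 {suc m} _ = s≤s z≤n

¬even⇒odd : ∀ m → ¬ Even m → Odd m
¬even⇒odd m ¬even with m % 2 | m%n<n m 2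
... | 0           | _               = contradiction refl ¬even
... | 1           | _               = refl
... | suc (suc _) | s≤s (s≤s ())

even-m+m : ∀ m → Even (m + m)
even-m+m m = trans (cong (_% 2) (m+m≡m*2 m)) (m*n%n≡0 m 2)
  where
  m+m≡m*2 : ∀ m → m + m ≡ m * 2
  m+m≡m*2 = solve-∀

[n+k]%2≡[[m+n]%2+[m+k]%2]%2 : ∀ m n k → (n + k) % 2 ≡ ((m + n) % 2 + (m + k) % 2) % 2
[n+k]%2≡[[m+n]%2+[m+k]%2]%2 m n k = begin
  (n + k) % 2             ≡⟨ [m+kn]%n≡m%n (n + k) m 2 ⟨
  (n + k + m * 2) % 2     ≡⟨ cong (_% 2) (regroup m n k) ⟩
  (m + n + (m + k)) % 2   ≡⟨ %-distribˡ-+ (m + n) (m + k) 2 ⟩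
  ((m + n) % 2 + (m + k) % 2) % 2 ∎
  where
  regroup : ∀ m n k → n + k + m * 2 ≡ m + n + (m + k)
  regroup = solve-∀

even-odd⇒odd : ∀ {m n k} → Even (m + n) → Odd (m + k) → Odd (n + k)
even-odd⇒odd {m} {n} {k} even odd
  rewrite [n+k]%2≡[[m+n]%2+[m+k]%2]%2 m n k | even | odd = refl

odd-odd⇒even : ∀ {m n k} → Odd (m + n) → Odd (m + k) → Even (n + k)
odd-odd⇒even {m} {n} {k} odd₁ odd₂
  rewrite [n+k]%2≡[[m+n]%2+[m+k]%2]%2 m n k | odd₁ | odd₂ = refl

m+n≡∣m-n∣+[m⊓n]*2 : ∀ m n → m + n ≡ ∣ m - n ∣ + (m ⊓ n) * 2
m+n≡∣m-n∣+[m⊓n]*2 zero    n       = sym (+-identityʳ n)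
m+n≡∣m-n∣+[m⊓n]*2 (suc m) zero    = refl
m+n≡∣m-n∣+[m⊓n]*2 (suc m) (suc n) = begin
  suc m + suc n                        ≡⟨ cong suc (+-suc m n) ⟩
  2 + (m + n)                          ≡⟨ cong (2 +_) (m+n≡∣m-n∣+[m⊓n]*2 m n) ⟩
  2 + (∣ m - n ∣ + (m ⊓ n) * 2)        ≡⟨ shift ∣ m - n ∣ ((m ⊓ n) * 2) ⟩
  ∣ m - n ∣ + (2 + (m ⊓ n) * 2)        ∎
  where
  shift : ∀ a b → 2 + (a + b) ≡ a + (2 + b)
  shift = solve-∀

odd-∣m-n∣ : ∀ m n → Odd (m + n) → Odd ∣ m - n ∣
odd-∣m-n∣ m n odd = begin
  ∣ m - n ∣ % 2                  ≡⟨ [m+kn]%n≡m%n ∣ m - n ∣ (m ⊓ n) 2 ⟨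
  (∣ m - n ∣ + (m ⊓ n) * 2) % 2  ≡⟨ cong (_% 2) (m+n≡∣m-n∣+[m⊓n]*2 m n) ⟨
  (m + n) % 2                    ≡⟨ odd ⟩
  1                              ∎

m≤n⇒d∣n∸m⇒n%d≡m%d : ∀ {m n d} .{{_ : NonZero d}} → m ≤ n → d ∣ n ∸ m → n % d ≡ m % d
m≤n⇒d∣n∸m⇒n%d≡m%d {m} {n} {d} m≤n d∣n∸m = begin
  n % d             ≡⟨ cong (_% d) (m+[n∸m]≡n m≤n) ⟨
  (m + (n ∸ m)) % d ≡⟨ %-remove-+ʳ m d∣n∸m ⟩
  m % d             ∎

d∣∣m-n∣⇒m%d≡n%d : ∀ m n {d} .{{_ : NonZero d}} → d ∣ ∣ m - n ∣ → m % d ≡ n % d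
d∣∣m-n∣⇒m%d≡n%d m n {d} d∣ with ≤-total m n
... | inj₁ m≤n = sym (m≤n⇒d∣n∸m⇒n%d≡m%d m≤n (subst (d ∣_) (m≤n⇒∣m-n∣≡n∸m m≤n) d∣))
... | inj₂ n≤m = m≤n⇒d∣n∸m⇒n%d≡m%d n≤m
                   (subst (d ∣_) (trans (∣-∣-comm m n) (m≤n⇒∣m-n∣≡n∸m n≤m)) d∣)

-- m = p * k with m odd rules out k = 2, and k ≥ 3 gives m ≥ 3 p.
odd-admissible : ∀ p {m} → Odd m → m < 3 * p ⊎ ¬ p ∣ m → Admissible p m
odd-admissible p {m} odd small-or-indivisible = odd , odd⇒>0 odd , not-multiple small-or-indivisible
  where
  not-multiple : m < 3 * p ⊎ ¬ p ∣ m → ¬ ∃ λ k → 2 ≤ k × m ≡ p * k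
  not-multiple _ (0 , () , _)
  not-multiple _ (1 , s≤s () , _)
  not-multiple (inj₂ p∤m) (k , _ , m≡pk) = p∤m (divides k (trans m≡pk (*-comm p k)))
  not-multiple (inj₁ _) (2 , _ , m≡2p) with () ← trans (sym odd) (trans (cong (_% 2) m≡2p) (m*n%n≡0 p 2))
  not-multiple (inj₁ m<3p) (suc (suc (suc k)) , _ , m≡pk) =
    <⇒≱ m<3p (subst₂ _≤_ (*-comm p 3) (sym m≡pk) (*-monoʳ-≤ p (m≤m+n 3 k)))

record Linked (p i j : ℕ) : Set where
  constructor _,_
  field
    sum-admissible  : Admissible p (i + j)
    diff-admissible : Admissible p ∣ i - j ∣

linked-sym : ∀ {p i j} → Linked p i j → Linked p j i
linked-sym {p} {i} {j} (sum , diff) =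
  subst (Admissible p) (+-comm i j) sum , subst (Admissible p) (∣-∣-comm i j) diff

linked⇒odd : ∀ {p i j} → Linked p i j → Odd (i + j)
linked⇒odd = proj₁ ∘ Linked.sum-admissible

linked-if-small : ∀ p {i j} → Odd (i + j) → i + j < 3 * p → Linked p i j
linked-if-small p {i} {j} odd small =
  odd-admissible p odd (inj₁ small) ,
  odd-admissible p (odd-∣m-n∣ i j odd)
    (inj₁ (≤-<-trans (≤-trans (∣m-n∣≤m⊔n i j) (m⊔n≤m+n i j)) small))

linked-if-apart : ∀ p .{{_ : NonZero p}} {i j} → Odd (i + j) → ¬ p ∣ i + j → i % p ≢ j % p → Linked p i j
linked-if-apart p {i} {j} odd p∤i+j i≢j =
  odd-admissible p odd (inj₂ p∤i+j) ,
  odd-admissible p (odd-∣m-n∣ i j odd) (inj₂ (i≢j ∘ d∣∣m-n∣⇒m%d≡n%d i j))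

InRange : ℕ → ℕ → Set
InRange n i = 1 ≤ i × i ≤ n

in-range≤1 : ∀ {n i} → n ≤ 1 → InRange n i → i ≡ 1
in-range≤1 n≤1 (1≤i , i≤n) = ≤-antisym (≤-trans i≤n n≤1) 1≤i

vertex : ∀ {n i} → InRange n i → Vertex n (2 * i)
vertex {i = i} (1≤i , i≤n) = i , 1≤i , i≤n , refl

2*m/2≡m : ∀ m → 2 * m / 2 ≡ m
2*m/2≡m m = trans (cong (_/ 2) (*-comm 2 m)) (m*n/n≡m m 2)

adjacent : ∀ {p n i j} → InRange n i → InRange n j → Linked p i j → Adj p n (2 * i) (2 * j)
adjacent {p} {n} {i} {j} i∈ j∈ (sum , diff) =
  vertex i∈ , vertex j∈ , 2i≢2j ,
  subst (Admissible p) (sym half-sum) sum , subst (Admissible p) (sym half-diff) diff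
  where
  2i≢2j : 2 * i ≢ 2 * j
  2i≢2j eq = <⇒≢ (proj₁ (proj₂ diff)) (sym (m≡n⇒∣m-n∣≡0 (*-cancelˡ-≡ i j 2 eq)))
  half-sum : (2 * i + 2 * j) / 2 ≡ i + j
  half-sum = trans (cong (_/ 2) (sym (*-distribˡ-+ 2 i j))) (2*m/2≡m (i + j))
  half-diff : ∣ 2 * i - 2 * j ∣ / 2 ≡ ∣ i - j ∣
  half-diff = trans (cong (_/ 2) (sym (*-distribˡ-∣-∣ 2 i j))) (2*m/2≡m ∣ i - j ∣)

walk-via : ∀ {p n i x j} → InRange n i → InRange n x → InRange n j →
           Linked p i x → Linked p x j → Walk p n (2 * i) (2 * j) 2
walk-via i∈ x∈ j∈ i-x x-j = step (adjacent i∈ x∈ i-x) (step (adjacent x∈ j∈ x-j) (here (vertex j∈)))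

Avoids± : ℕ → ℕ → Set
Avoids± r x = r ≢ x % 5 × (r + x % 5) % 5 ≢ 0

linked-if-avoids : ∀ {i x} → Odd (i + x) → Avoids± (i % 5) x → Linked 5 i x
linked-if-avoids {i} {x} odd (i≢x , i≢-x) = linked-if-apart 5 odd 5∤i+x i≢x
  where
  5∤i+x : ¬ 5 ∣ i + x
  5∤i+x 5∣i+x = i≢-x (trans (sym (%-distribˡ-+ i x 5)) (n∣m⇒m%n≡0 (i + x) 5 5∣i+x))

Candidate : ℕ → ℕ → ℕ → ℕ → Set
Candidate q r s x = 1 ≤ x × (q + x % 2) % 2 ≡ 1 × Avoids± r x × Avoids± s x

candidate? : ∀ q r s x → Dec (Candidate q r s x)
candidate? q r s x = 1 ≤? x ×-dec ((q + x % 2) % 2 ≟ 1) ×-dec avoids? r ×-dec avoids? s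
  where
  avoids? : ∀ r → Dec (Avoids± r x)
  avoids? r = ¬? (r ≟ x % 5) ×-dec ¬? ((r + x % 5) % 5 ≟ 0)

-- Holds because the five numbers in 1 … 10 of a given parity meet every residue
-- class mod 5, while Avoids± r and Avoids± s exclude at most four of them.
candidate-table : ∀ (q : Fin 2) (r s : Fin 5) →
                  ∃ λ (x : Fin 11) → Candidate (toℕ q) (toℕ r) (toℕ s) (toℕ x)
candidate-table = toWitness {a? = all? λ q → all? λ r → all? λ s → any? λ x →
                                    candidate? (toℕ q) (toℕ r) (toℕ s) (toℕ x)} tt

candidate : ∀ {q r s} → q < 2 → r < 5 → s < 5 → ∃ λ x → x ≤ 10 × Candidate q r s x
candidate q<2 r<5 s<5
  with x , cand ← candidate-table (fromℕ< q<2) (fromℕ< r<5) (fromℕ< s<5)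
  rewrite toℕ-fromℕ< q<2 | toℕ-fromℕ< r<5 | toℕ-fromℕ< s<5 = toℕ x , toℕ≤pred[n] x , cand

opposite-parity≤2 : ∀ i → ∃ λ x → InRange 2 x × Odd (i + x)
opposite-parity≤2 i with i % 2 ≟ 0
... | yes even = 1 , (≤-refl , s≤s z≤n) , trans (%-distribˡ-+ i 1 2) (cong (λ r → (r + 1) % 2) even)
... | no ¬even = 2 , (s≤s z≤n , ≤-refl) , trans ([m+n]%n≡m%n i 2) (¬even⇒odd i ¬even)

CommonNeighbour : ℕ → ℕ → ℕ → Set
CommonNeighbour n i j = ∃ λ x → InRange n x × Linked 5 i x × Linked 5 x j

common-neighbour-large : ∀ {n i j} → 10 ≤ n → Even (i + j) → CommonNeighbour n i j
common-neighbour-large {n} {i} {j} 10≤n even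
  with x , x≤10 , 1≤x , odd , i-avoids , j-avoids ← candidate (m%n<n i 2) (m%n<n i 5) (m%n<n j 5) =
  x , (1≤x , ≤-trans x≤10 10≤n) ,
  linked-if-avoids odd-i+x i-avoids ,
  linked-sym (linked-if-avoids (even-odd⇒odd {i} even odd-i+x) j-avoids)
  where
  odd-i+x : Odd (i + x)
  odd-i+x = trans (%-distribˡ-+ i x 2) odd

-- With x ≤ 2 and i, j ≤ 9 all sums stay below 15, the least forbidden value.
common-neighbour-small : ∀ {n i j} → 2 ≤ n → n ≤ 9 → InRange n i → InRange n j → Even (i + j) →
                         CommonNeighbour n i j
common-neighbour-small {n} {i} {j} 2≤n n≤9 (_ , i≤n) (_ , j≤n) even
  with x , (1≤x , x≤2) , odd-i+x ← opposite-parity≤2 i =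
  x , (1≤x , ≤-trans x≤2 2≤n) ,
  linked-if-small 5 odd-i+x (sum<15 i≤n) ,
  linked-sym (linked-if-small 5 (even-odd⇒odd {i} even odd-i+x) (sum<15 j≤n))
  where
  sum<15 : ∀ {k} → k ≤ n → k + x < 15
  sum<15 k≤n = s≤s (≤-trans (+-mono-≤ (≤-trans k≤n n≤9) x≤2) (m≤m+n 11 3))

common-neighbour : ∀ {n i j} → 2 ≤ n → InRange n i → InRange n j → Even (i + j) → CommonNeighbour n i j
common-neighbour {n} 2≤n i∈ j∈ even with 10 ≤? n
... | yes 10≤n = common-neighbour-large 10≤n even
... | no 10≰n  = common-neighbour-small 2≤n (≤-pred (≰⇒> 10≰n)) i∈ j∈ even

neighbour : ∀ {n i} → 2 ≤ n → InRange n i → ∃ λ x → InRange n x × Linked 5 i x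
neighbour {i = i} 2≤n i∈
  with x , x∈ , i-x , _ ← common-neighbour 2≤n i∈ i∈ (even-m+m i) = x , x∈ , i-x

index-distance≤3 : ∀ {n i j} → InRange n i → InRange n j →
                   ∃ λ ℓ → ℓ ≤ 3 × Walk 5 n (2 * i) (2 * j) ℓ
index-distance≤3 {n} {i} {j} i∈ j∈ with 2 ≤? n | (i + j) % 2 ≟ 0
... | no 2≰n | _ = 0 , z≤n , subst (λ k → Walk 5 n (2 * i) (2 * k) 0) i≡j (here (vertex i∈))
  where
  n≤1 : n ≤ 1
  n≤1 = ≤-pred (≰⇒> 2≰n)
  i≡j : i ≡ j
  i≡j = trans (in-range≤1 n≤1 i∈) (sym (in-range≤1 n≤1 j∈))
... | yes 2≤n | yes even
  with x , x∈ , i-x , x-j ← common-neighbour 2≤n i∈ j∈ even =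
  2 , s≤s (s≤s z≤n) , walk-via i∈ x∈ j∈ i-x x-j
... | yes 2≤n | no ¬even
  with x , x∈ , i-x ← neighbour 2≤n i∈
  with y , y∈ , x-y , y-j ← common-neighbour 2≤n x∈ j∈
                               (odd-odd⇒even {i} (linked⇒odd i-x) (¬even⇒odd (i + j) ¬even)) =
  3 , ≤-refl , step (adjacent i∈ x∈ i-x) (walk-via x∈ y∈ j∈ x-y y-j)

distance≤3 : ∀ n → DiameterAtMost 5 n 3
distance≤3 n _ _ (i , 1≤i , i≤n , refl) (j , 1≤j , j≤n , refl) = index-distance≤3 (1≤i , i≤n) (1≤j , j≤n)

diameter⇒connected : ∀ {p n d} → DiameterAtMost p n d → Connected p n
diameter⇒connected diam a b a∈ b∈ with ℓ , _ , walk ← diam a b a∈ b∈ = ℓ , walk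

theorem5p4 : ∀ (n : ℕ) → Connected 5 n × DiameterAtMost 5 n 3
theorem5p4 n = diameter⇒connected (distance≤3 n) , distance≤3 n
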